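{- For any two m-saturated dependence epistemic models $\mathcal{M}$ and $\mathcal{M}'$ and any $s\in S$, $s'\in S'$: there is a bisimulation $B$ between $\mathcal{M}$ and $\mathcal{M}'$ with $sBs'$ if and only if $\mathcal{M},s$ and $\mathcal{M}',s'$ satisfy exactly the same $\textbf{EDL}$-formulas.
   Context: Fix countable sets $\mathbb{P}$ (propositions) and $\mathbb{V}$ (variables). $\textbf{EDL}$ formulas: $\phi::=\top\mid p\mid\neg\phi\mid(\phi\land\phi)\mid\mathcal{K}\phi\mid\mathcal{A}\phi\mid\mathcal{D}_g(X,Y)\mid\mathcal{D}_l(X,Y)$ with $p\in\mathbb{P}$ and $X,Y$ finite subsets of $\mathbb{V}$. A dependence epistemic model is $\mathcal{M}=\langle S,T,V,U,\sim_i,\approx\rangle$: $S$ a set of worlds, $T:S\times\mathbb{P}\to\{0,1\}$, $V\supseteq\mathbb{V}$ a countable set of variables, $U:S\times V\to\mathbb{N}$, $\sim_i,\approx$ equivalence relations on $S$. For $X\subseteq V$, $X_s=X_t$ iff $U(s,x)=U(t,x)$ for all $x\in X$, else $X_s\neq X_t$. Semantics: $\top$ always true; $s\vDash p$ iff $T(s,p)=1$; Boolean clauses as usual; $s\vDash\mathcal{K}\phi$ iff $t\vDash\phi$ for all $t\sim_i s$; $s\vDash\mathcal{A}\phi$ iff $t\vDash\phi$ for all $t\approx s$; $s\vDash\mathcal{D}_g(X,Y)$ iff there exist $u\approx v\approx s$ with $(V\setminus(X\cup Y))_u=(V\setminus(X\cup Y))_v$, $X_u\neq X_v$, $Y_u\neq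 Y_v$; $s\vDash\mathcal{D}_l(X,Y)$ iff there exists $t\approx s$ with $(V\setminus(X\cup Y))_t=(V\setminus(X\cup Y))_s$, $X_t\neq X_s$, $Y_t\neq Y_s$. For $u,v\in S$, $\Delta(u,v)=\{x\in\mathbb{V}\mid U(u,x)\neq U(v,x)\}$ if $(V\setminus\mathbb{V})_u=(V\setminus\mathbb{V})_v$, else $\emptyset$. $W$ is an evidence of $\langle X,Y\rangle$ iff $W\cap X\neq\emptyset$, $W\cap Y\neq\emptyset$, $W\subseteq X\cup Y$. $\mathcal{P}_g(s)=\{\Delta(u,v)\mid u\approx v\approx s,\ \Delta(u,v)\text{ nonempty finite}\}$, $\mathcal{P}_l(s)=\{\Delta(t,s)\mid t\approx s,\ \Delta(t,s)\text{ nonempty finite}\}$. A nonempty finite $W\subseteq\mathbb{V}$ is generative from $\mathcal{P}(s)$ iff for all finite $X,Y\subseteq\mathbb{V}$ such that $W$ is an evidence of $\langle X,Y\rangle$ some $W'\in\mathcal{P}(s)$ is an evidence of $\langle X,Y\rangle$; $\mathfrak{G}_g(s)$, $\mathfrak{G}_l(s)$ are the sets of nonempty finite $W\subseteq\mathbb{V}$ generative from $\mathcal{P}_g(s)$, $\mathcal{P}_l(s)$ respectively. A nonempty relation $B\subseteq S\times S'$ is a bisimulation iff whenever $sBs'$: $T(s,p)=T'(s',p)$ for all $p\in\mathbb{P}$; $\mathfrak{G}_g(s)=\mathfrak{G}_g(s')$; $\mathfrak{G}_l(s)=\mathfrak{G}_l(s')$; for each of the relations $R\in\{\sim_i,\approx\}$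 (with counterpart $R'$ in $\mathcal{M}'$): if $sRt$ then there is $t'$ with $s'R't'$ and $tBt'$, and if $s'R't'$ then there is $t$ with $sRt$ and $tBt'$. A model is m-saturated (in the sense of Blackburn–de Rijke–Venema, Def. 2.53) iff for each world $s$, each relation $R\in\{\sim_i,\approx\}$ and each set $\Sigma$ of $\textbf{EDL}$-formulas: if every finite subset of $\Sigma$ is satisfied at some $R$-successor of $s$, then $\Sigma$ is satisfied at some $R$-successor of $s$. -}

module Defs where

open import Data.Nat using (ℕ)
open import Data.Bool using (Bool; true)
open import Data.List using (List; _++_)
open import Data.List.Membership.Propositional using (_∈_)
open import Data.Product using (Σ; ∃; ∃-syntax; _×_; _,_)
open import Data.Sum using (_⊎_; inj₁; inj₂)
open import Data.Empty using (⊥)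
open import Relation.Nullary using (¬_)
open import Relation.Binary.PropositionalEquality using (_≡_; _≢_)
open import Relation.Binary.Structures using (IsEquivalence)
open import Function.Definitions using (Injective)

Countable : Set → Set
Countable A = Σ (A → ℕ) (λ f → Injective _≡_ _≡_ f)

module EDL (Prop Var : Set) where

  -- Finite subsets of 𝕍 are represented by lists.
  FinSub : Set
  FinSub = List Var

  data Form : Set where
    ⊤ᶠ  : Form
    atom : Prop → Form
    ¬ᶠ_ : Form → Form
    _∧ᶠ_ : Form → Form → Form
    𝒦   : Form → Form
    𝒜   : Form → Form
    𝒟g  : FinSub → FinSub → Form
    𝒟l  : FinSub → FinSub → Form

  -- Dependence epistemic model.  The variable set V ⊇ 𝕍 is represented as
  -- 𝕍 ⊎ Extra, where Extra = V ∖ 𝕍 is countable.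
  record Model : Set₁ where
    field
      S        : Set
      T        : S → Prop → Bool
      Extra    : Set
      Extra-countable : Countable Extra
      U        : S → (Var ⊎ Extra) → ℕ
      _∼_      : S → S → Set
      ∼-equiv  : IsEquivalence _∼_
      _≈_      : S → S → Set
      ≈-equiv  : IsEquivalence _≈_

    V : Set
    V = Var ⊎ Extra

    _∈V_ : V → FinSub → Set
    w ∈V X = ∃[ x ] (x ∈ X × w ≡ inj₁ x)

    AgreeOutside : FinSub → FinSub → S → S → Set
    AgreeOutside X Y u v = ∀ (w : V) → ¬ (w ∈V (X ++ Y)) → U u w ≡ U v w

    AgreeOn : FinSub → S → S → Set
    AgreeOn X u v = ∀ x → x ∈ X → U u (inj₁ x) ≡ U v (inj₁ x)

    _⊨_ : S → Form → Set
    s ⊨ ⊤ᶠ = Data.Unit.⊤ where import Data.Unit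
    s ⊨ atom p = T s p ≡ true
    s ⊨ (¬ᶠ φ) = ¬ (s ⊨ φ)
    s ⊨ (φ ∧ᶠ ψ) = (s ⊨ φ) × (s ⊨ ψ)
    s ⊨ 𝒦 φ = ∀ t → s ∼ t → t ⊨ φ
    s ⊨ 𝒜 φ = ∀ t → s ≈ t → t ⊨ φ
    s ⊨ 𝒟g X Y = ∃[ u ] ∃[ v ] (u ≈ v × v ≈ s × AgreeOutside X Y u v
                   × ¬ AgreeOn X u v × ¬ AgreeOn Y u v)
    s ⊨ 𝒟l X Y = ∃[ t ] (t ≈ s × AgreeOutside X Y t s
                   × ¬ AgreeOn X t s × ¬ AgreeOn Y t s)

    -- Δ(u,v) as a subset of 𝕍 (a predicate): x ∈ Δ(u,v) iff
    -- (V∖𝕍)_u = (V∖𝕍)_v and U(u,x) ≠ U(v,x)  (otherwise Δ(u,v) = ∅).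
    Δ : S → S → Var → Set
    Δ u v x = (∀ (e : Extra) → U u (inj₂ e) ≡ U v (inj₂ e)) × (U u (inj₁ x) ≢ U v (inj₁ x))

    NonemptyFinite : (Var → Set) → Set
    NonemptyFinite W = (∃[ x ] W x) × (∃[ L ] (∀ x → W x → x ∈ L))

    Evidence : (Var → Set) → FinSub → FinSub → Set
    Evidence W X Y = (∃[ x ] (x ∈ X × W x)) × (∃[ y ] (y ∈ Y × W y))
                     × (∀ z → W z → z ∈ X ⊎ z ∈ Y)

    SomePgEvidence : S → FinSub → FinSub → Set
    SomePgEvidence s X Y = ∃[ u ] ∃[ v ] (u ≈ v × v ≈ s
                             × NonemptyFinite (Δ u v) × Evidence (Δ u v) X Y)

    SomePlEvidence : S → FinSub → FinSub → Set
    SomePlEvidence s X Y = ∃[ t ] (t ≈ s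
                             × NonemptyFinite (Δ t s) × Evidence (Δ t s) X Y)

    ListSet : List Var → Var → Set
    ListSet W x = x ∈ W

    𝔊g : S → List Var → Set
    𝔊g s W = NonemptyFinite (ListSet W) ×
             (∀ X Y → Evidence (ListSet W) X Y → SomePgEvidence s X Y)

    𝔊l : S → List Var → Set
    𝔊l s W = NonemptyFinite (ListSet W) ×
             (∀ X Y → Evidence (ListSet W) X Y → SomePlEvidence s X Y)

    SaturatedFor : (S → S → Set) → Set₁
    SaturatedFor R = ∀ (s : S) (Σ' : Form → Set) →
      (∀ (Δ' : List Form) → (∀ φ → φ ∈ Δ' → Σ' φ) →
         ∃[ t ] (R s t × (∀ φ → φ ∈ Δ' → t ⊨ φ))) →
      ∃[ t ] (R s t × (∀ φ → Σ' φ → t ⊨ φ))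

    MSaturated : Set₁
    MSaturated = SaturatedFor _∼_ × SaturatedFor _≈_

  open Model

  ForthBack : (M M' : Model) → (S M → S M' → Set) →
              (S M → S M → Set) → (S M' → S M' → Set) → Set
  ForthBack M M' B R R' = ∀ s s' → B s s' →
      (∀ t → R s t → ∃[ t' ] (R' s' t' × B t t'))
    × (∀ t' → R' s' t' → ∃[ t ] (R s t × B t t'))

  IsBisimulation : (M M' : Model) → (S M → S M' → Set) → Set
  IsBisimulation M M' B =
      (∃[ s ] ∃[ s' ] B s s')
    × (∀ s s' → B s s' →
         (∀ p → T M s p ≡ T M' s' p)
       × (∀ W → (𝔊g M s W → 𝔊g M' s' W) × (𝔊g M' s' W → 𝔊g M s W))
       × (∀ W → (𝔊l M s W → 𝔊l M' s' W) × (𝔊l M' s' W → 𝔊l M s W)))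
    × ForthBack M M' B (_∼_ M) (_∼_ M')
    × ForthBack M M' B (_≈_ M) (_≈_ M')

  ModallyEquivalent : (M M' : Model) → S M → S M' → Set
  ModallyEquivalent M M' s s' =
    ∀ φ → (_⊨_ M s φ → _⊨_ M' s' φ) × (_⊨_ M' s' φ → _⊨_ M s φ)

-- Two worlds u, v witness 𝒟(X,Y) exactly when Δ(u,v) is a nonempty finite
-- evidence of ⟨X,Y⟩.  Consequently 𝒟g X Y (resp. 𝒟l X Y) holds at s iff some
-- member of 𝔊g(s) (resp. 𝔊l(s)) is an evidence of ⟨X,Y⟩, so the sets 𝔊
-- carry exactly the information of the dependence formulas true at a world.
-- Both directions are then the classical Hennessy–Milner argument: bisimilar
-- worlds agree on every formula by induction, and on m-saturated models modal
-- equivalence is itself a bisimulation, the forth condition coming from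
-- saturation applied to the theory of the successor.
module Submission where

open import Defs
open import Data.Product using (∃-syntax; _×_)
open import Axiom.ExcludedMiddle using (ExcludedMiddle)
open import Level using (0ℓ)

open import Axiom.DoubleNegationElimination using (em⇒dne)
open import Data.Bool using (Bool; true; false)
open import Data.List using (List; []; _∷_; _++_; filter)
open import Data.List.Membership.Propositional using (_∈_)
open import Data.List.Membership.Propositional.Properties
  using (∈-++⁺ˡ; ∈-++⁺ʳ; ∈-++⁻; ∈-filter⁺; ∈-filter⁻)
open import Data.List.Relation.Unary.Any using (here; there)
open import Data.Product using (_,_; proj₁; proj₂; map; swap)
open import Data.Sum using (inj₁; inj₂; [_,_])
open import Data.Unit using (tt)
open import Function using (id)
open import Relation.Nullary using (¬_; Stable)
open import Relation.Unary using (Decidable)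
open import Relation.Binary.PropositionalEquality using (_≡_; _≢_; refl; sym; trans)

infix 0 _⇔_

_⇔_ : Set → Set → Set
A ⇔ B = (A → B) × (B → A)

≡true-injective : (a b : Bool) → (a ≡ true) ⇔ (b ≡ true) → a ≡ b
≡true-injective true  b     (a⇒b , _) = sym (a⇒b refl)
≡true-injective false true  (_ , b⇒a) = b⇒a refl
≡true-injective false false _         = refl

module Classical (em : ExcludedMiddle 0ℓ) {Prop Var : Set} where
  open EDL Prop Var

  stable : {P : Set} → Stable P
  stable = em⇒dne em

  listed : {P : Var → Set} → ∃[ L ] (∀ x → P x → x ∈ L) → ∃[ W ] (∀ x → x ∈ W ⇔ P x)
  listed {P} (L , P⊆L) = filter P? L , λ x →
    (λ x∈W → proj₂ (∈-filter⁻ P? {xs = L} x∈W)) , λ Px → ∈-filter⁺ P? (P⊆L x Px) Px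
    where
    P? : Decidable P
    P? _ = em

  module Dependence (M : Model) where
    open Model M

    Dependent : FinSub → FinSub → S → S → Set
    Dependent X Y u v = AgreeOutside X Y u v × ¬ AgreeOn X u v × ¬ AgreeOn Y u v

    Witnesses : FinSub → FinSub → S → S → Set
    Witnesses X Y u v = NonemptyFinite (Δ u v) × Evidence (Δ u v) X Y

    evidence-resp : ∀ {P Q : Var → Set} {X Y} → (∀ x → P x ⇔ Q x) →
                    Evidence P X Y → Evidence Q X Y
    evidence-resp P⇔Q ((x , x∈X , Px) , (y , y∈Y , Py) , P⊆X∪Y) =
      (x , x∈X , proj₁ (P⇔Q x) Px) , (y , y∈Y , proj₁ (P⇔Q y) Py) ,
      λ z Qz → P⊆X∪Y z (proj₂ (P⇔Q z) Qz)

    disagreement : ∀ {u v} X → ¬ AgreeOn X u v →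
                   ∃[ x ] (x ∈ X × U u (inj₁ x) ≢ U v (inj₁ x))
    disagreement X ¬agree =
      stable λ none → ¬agree λ x x∈X → stable λ x≢ → none (x , x∈X , x≢)

    Δ⊆X++Y : ∀ {u v} X Y → AgreeOutside X Y u v → ∀ z → Δ u v z → z ∈ X ++ Y
    Δ⊆X++Y X Y agree z (_ , z≢) =
      stable λ z∉ → z≢ (agree (inj₁ z) λ { (_ , z∈ , refl) → z∉ z∈ })

    witnesses⇒dependent : ∀ {X Y u v} → Witnesses X Y u v → Dependent X Y u v
    witnesses⇒dependent {X} {Y} {u} {v}
      (((_ , extras , _) , _) , (x , x∈X , _ , x≢) , (y , y∈Y , _ , y≢) , Δ⊆X∪Y) =
      agree , (λ agreeX → x≢ (agreeX x x∈X)) , (λ agreeY → y≢ (agreeY y y∈Y))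
      where
      agree : AgreeOutside X Y u v
      agree (inj₂ e) _  = extras e
      agree (inj₁ z) z∉ = stable λ z≢ →
        z∉ (z , [ ∈-++⁺ˡ , ∈-++⁺ʳ X ] (Δ⊆X∪Y z (extras , z≢)) , refl)

    dependent⇒witnesses : ∀ {X Y u v} → Dependent X Y u v → Witnesses X Y u v
    dependent⇒witnesses {X} {Y} {u} {v} (agree , ¬agreeX , ¬agreeY)
      with disagreement X ¬agreeX | disagreement Y ¬agreeY
    ... | x , x∈X , x≢ | y , y∈Y , y≢ =
      ((x , extras , x≢) , X ++ Y , Δ⊆X++Y X Y agree) ,
      (x , x∈X , extras , x≢) , (y , y∈Y , extras , y≢) ,
      λ z Δz → ∈-++⁻ X (Δ⊆X++Y X Y agree z Δz)
      where
      extras : ∀ e → U u (inj₂ e) ≡ U v (inj₂ e)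
      extras e = agree (inj₂ e) λ { (_ , _ , ()) }

    witnesses⇒listed : ∀ {X Y u v} → Witnesses X Y u v →
      ∃[ W ] (NonemptyFinite (ListSet W) × Evidence (ListSet W) X Y
              × (∀ X' Y' → Evidence (ListSet W) X' Y' → Witnesses X' Y' u v))
    witnesses⇒listed (nonempty@((x , Δx) , finite) , evidence) with listed finite
    ... | W , W⇔Δ =
      W , ((x , proj₂ (W⇔Δ x) Δx) , W , λ _ → id) ,
      evidence-resp (λ z → swap (W⇔Δ z)) evidence ,
      λ _ _ evidence' → nonempty , evidence-resp W⇔Δ evidence'

    ⊨𝒟g⇔evidence : ∀ {s X Y} → s ⊨ 𝒟g X Y ⇔ SomePgEvidence s X Y
    ⊨𝒟g⇔evidence =
      (λ (u , v , u≈v , v≈s , dep) → u , v , u≈v , v≈s , dependent⇒witnesses dep) ,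
      (λ (u , v , u≈v , v≈s , wit) → u , v , u≈v , v≈s , witnesses⇒dependent wit)

    ⊨𝒟l⇔evidence : ∀ {s X Y} → s ⊨ 𝒟l X Y ⇔ SomePlEvidence s X Y
    ⊨𝒟l⇔evidence =
      (λ (t , t≈s , dep) → t , t≈s , dependent⇒witnesses dep) ,
      (λ (t , t≈s , wit) → t , t≈s , witnesses⇒dependent wit)

    ⊨𝒟g⇔generative : ∀ {s X Y} → s ⊨ 𝒟g X Y ⇔ ∃[ W ] (𝔊g s W × Evidence (ListSet W) X Y)
    ⊨𝒟g⇔generative = to , λ (_ , (_ , generative) , evidence) →
      proj₂ ⊨𝒟g⇔evidence (generative _ _ evidence)
      where
      to : ∀ {s X Y} → s ⊨ 𝒟g X Y → ∃[ W ] (𝔊g s W × Evidence (ListSet W) X Y)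
      to (u , v , u≈v , v≈s , dep) with witnesses⇒listed (dependent⇒witnesses dep)
      ... | W , nonempty , evidence , witnessing =
        W , (nonempty , λ X' Y' e → u , v , u≈v , v≈s , witnessing X' Y' e) , evidence

    ⊨𝒟l⇔generative : ∀ {s X Y} → s ⊨ 𝒟l X Y ⇔ ∃[ W ] (𝔊l s W × Evidence (ListSet W) X Y)
    ⊨𝒟l⇔generative = to , λ (_ , (_ , generative) , evidence) →
      proj₂ ⊨𝒟l⇔evidence (generative _ _ evidence)
      where
      to : ∀ {s X Y} → s ⊨ 𝒟l X Y → ∃[ W ] (𝔊l s W × Evidence (ListSet W) X Y)
      to (t , t≈s , dep) with witnesses⇒listed (dependent⇒witnesses dep)
      ... | W , nonempty , evidence , witnessing =
        W , (nonempty , λ X' Y' e → t , t≈s , witnessing X' Y' e) , evidence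

  open Model using (S; T; 𝔊g; 𝔊l; _∼_; _≈_; SaturatedFor; MSaturated)

  infix 5 _∣_⊨_

  _∣_⊨_ : (M : Model) → S M → Form → Set
  M ∣ s ⊨ φ = Model._⊨_ M s φ

  ⋀ : List Form → Form
  ⋀ []      = ⊤ᶠ
  ⋀ (φ ∷ Γ) = φ ∧ᶠ ⋀ Γ

  ⊨⋀⁺ : ∀ M {t} Γ → (∀ φ → φ ∈ Γ → M ∣ t ⊨ φ) → M ∣ t ⊨ ⋀ Γ
  ⊨⋀⁺ M []      _   = tt
  ⊨⋀⁺ M (φ ∷ Γ) t⊨Γ = t⊨Γ φ (here refl) , ⊨⋀⁺ M Γ (λ ψ ψ∈Γ → t⊨Γ ψ (there ψ∈Γ))

  ⊨⋀⁻ : ∀ M {t} Γ → M ∣ t ⊨ ⋀ Γ → ∀ φ → φ ∈ Γ → M ∣ t ⊨ φ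
  ⊨⋀⁻ M (φ ∷ Γ) (t⊨φ , _)   _ (here refl) = t⊨φ
  ⊨⋀⁻ M (φ ∷ Γ) (_ , t⊨⋀Γ)  ψ (there ψ∈Γ) = ⊨⋀⁻ M Γ t⊨⋀Γ ψ ψ∈Γ

  ModallyEquivalent-sym : ∀ M M' {s s'} → ModallyEquivalent M M' s s' → ModallyEquivalent M' M s' s
  ModallyEquivalent-sym _ _ s≡s' φ = swap (s≡s' φ)

  theory⊆⇒equivalent : ∀ M M' {t t'} → (∀ φ → M ∣ t ⊨ φ → M' ∣ t' ⊨ φ) →
                       ModallyEquivalent M M' t t'
  theory⊆⇒equivalent _ _ t⊨⇒t'⊨ φ =
    t⊨⇒t'⊨ φ , λ t'⊨φ → stable λ t⊭φ → t⊨⇒t'⊨ (¬ᶠ φ) t⊭φ t'⊨φ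

  Harmonious : ∀ M M' → S M → S M' → Set
  Harmonious M M' s s' = (∀ p → T M s p ≡ T M' s' p)
                       × (∀ W → 𝔊g M s W ⇔ 𝔊g M' s' W)
                       × (∀ W → 𝔊l M s W ⇔ 𝔊l M' s' W)

  module Transfer (M M' : Model) where
    module D  = Dependence M
    module D' = Dependence M'

    ⊨𝒟g-transfer : ∀ {s s' X Y} → (∀ W → 𝔊g M s W → 𝔊g M' s' W) →
                   M ∣ s ⊨ 𝒟g X Y → M' ∣ s' ⊨ 𝒟g X Y
    ⊨𝒟g-transfer 𝔊⊆ s⊨ with proj₁ D.⊨𝒟g⇔generative s⊨
    ... | W , generative , evidence = proj₂ D'.⊨𝒟g⇔generative (W , 𝔊⊆ W generative , evidence)

    ⊨𝒟l-transfer : ∀ {s s' X Y} → (∀ W → 𝔊l M s W → 𝔊l M' s' W) →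
                   M ∣ s ⊨ 𝒟l X Y → M' ∣ s' ⊨ 𝒟l X Y
    ⊨𝒟l-transfer 𝔊⊆ s⊨ with proj₁ D.⊨𝒟l⇔generative s⊨
    ... | W , generative , evidence = proj₂ D'.⊨𝒟l⇔generative (W , 𝔊⊆ W generative , evidence)

    𝔊g-transfer : ∀ {s s' W} → (∀ X Y → M ∣ s ⊨ 𝒟g X Y → M' ∣ s' ⊨ 𝒟g X Y) →
                  𝔊g M s W → 𝔊g M' s' W
    𝔊g-transfer ⊨⇒ (nonempty , generative) = nonempty , λ X Y evidence →
      proj₁ D'.⊨𝒟g⇔evidence (⊨⇒ X Y (proj₂ D.⊨𝒟g⇔evidence (generative X Y evidence)))

    𝔊l-transfer : ∀ {s s' W} → (∀ X Y → M ∣ s ⊨ 𝒟l X Y → M' ∣ s' ⊨ 𝒟l X Y) →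
                  𝔊l M s W → 𝔊l M' s' W
    𝔊l-transfer ⊨⇒ (nonempty , generative) = nonempty , λ X Y evidence →
      proj₁ D'.⊨𝒟l⇔evidence (⊨⇒ X Y (proj₂ D.⊨𝒟l⇔evidence (generative X Y evidence)))

  equivalent⇒harmonious : ∀ M M' {s s'} → ModallyEquivalent M M' s s' → Harmonious M M' s s'
  equivalent⇒harmonious M M' s≡s' =
    (λ p → ≡true-injective _ _ (s≡s' (atom p))) ,
    (λ _ → Transfer.𝔊g-transfer M M' (λ X Y → proj₁ (s≡s' (𝒟g X Y))) ,
           Transfer.𝔊g-transfer M' M (λ X Y → proj₂ (s≡s' (𝒟g X Y)))) ,
    (λ _ → Transfer.𝔊l-transfer M M' (λ X Y → proj₁ (s≡s' (𝒟l X Y))) ,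
           Transfer.𝔊l-transfer M' M (λ X Y → proj₂ (s≡s' (𝒟l X Y))))

  module Invariance (M M' : Model) (B : S M → S M' → Set) (bisim : IsBisimulation M M' B) where

    harmony : ∀ {s s'} → B s s' → Harmonious M M' s s'
    harmony = proj₁ (proj₂ bisim) _ _

    □-invariant : ∀ {R : S M → S M → Set} {R' : S M' → S M' → Set} {φ s s'} →
      ForthBack M M' B R R' → B s s' →
      (∀ {t t'} → B t t' → M ∣ t ⊨ φ ⇔ M' ∣ t' ⊨ φ) →
      (∀ t → R s t → M ∣ t ⊨ φ) ⇔ (∀ t' → R' s' t' → M' ∣ t' ⊨ φ)
    □-invariant forthBack b φ-invariant =
      (λ s⊨□φ t' s'Rt' → let t , sRt , bt = proj₂ (forthBack _ _ b) t' s'Rt'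
                         in proj₁ (φ-invariant bt) (s⊨□φ t sRt)) ,
      (λ s'⊨□φ t sRt → let t' , s'Rt' , bt = proj₁ (forthBack _ _ b) t sRt
                       in proj₂ (φ-invariant bt) (s'⊨□φ t' s'Rt'))

    ⊨-invariant : ∀ φ {s s'} → B s s' → M ∣ s ⊨ φ ⇔ M' ∣ s' ⊨ φ
    ⊨-invariant ⊤ᶠ       _ = _
    ⊨-invariant (atom p) b = trans (sym T≡) , trans T≡
      where T≡ = proj₁ (harmony b) p
    ⊨-invariant (¬ᶠ φ)   b = (λ s⊭φ s'⊨φ → s⊭φ (proj₂ ih s'⊨φ)) , (λ s'⊭φ s⊨φ → s'⊭φ (proj₁ ih s⊨φ))
      where ih = ⊨-invariant φ b
    ⊨-invariant (φ ∧ᶠ ψ) b = map (proj₁ ihφ) (proj₁ ihψ) , map (proj₂ ihφ) (proj₂ ihψ)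
      where ihφ = ⊨-invariant φ b
            ihψ = ⊨-invariant ψ b
    ⊨-invariant (𝒦 φ)    b = □-invariant (proj₁ (proj₂ (proj₂ bisim))) b (⊨-invariant φ)
    ⊨-invariant (𝒜 φ)    b = □-invariant (proj₂ (proj₂ (proj₂ bisim))) b (⊨-invariant φ)
    ⊨-invariant (𝒟g X Y) b = Transfer.⊨𝒟g-transfer M M' (λ W → proj₁ (𝔊⇔ W)) ,
                             Transfer.⊨𝒟g-transfer M' M (λ W → proj₂ (𝔊⇔ W))
      where 𝔊⇔ = proj₁ (proj₂ (harmony b))
    ⊨-invariant (𝒟l X Y) b = Transfer.⊨𝒟l-transfer M M' (λ W → proj₁ (𝔊⇔ W)) ,
                             Transfer.⊨𝒟l-transfer M' M (λ W → proj₂ (𝔊⇔ W))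
      where 𝔊⇔ = proj₂ (proj₂ (harmony b))

  bisimilar⇒equivalent : ∀ M M' {s s'} → ∃[ B ] (IsBisimulation M M' B × B s s') →
                         ModallyEquivalent M M' s s'
  bisimilar⇒equivalent M M' (B , bisim , b) φ = Invariance.⊨-invariant M M' B bisim φ b

  module HennessyMilner (□ : Form → Form) (R : (M : Model) → S M → S M → Set)
    (□-semantics : ∀ M {s φ} → M ∣ s ⊨ □ φ ⇔ (∀ t → R M s t → M ∣ t ⊨ φ)) where

    -- t ⊨ ⋀ Γ makes s ⊨ ¬ □ ¬ ⋀ Γ, which then holds at s' as well.
    finitely-realised : ∀ M M' {s s' t} → ModallyEquivalent M M' s s' → R M s t →
      ∀ Γ → (∀ φ → φ ∈ Γ → M ∣ t ⊨ φ) → ∃[ t' ] (R M' s' t' × ∀ φ → φ ∈ Γ → M' ∣ t' ⊨ φ)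
    finitely-realised M M' {t = t} s≡s' sRt Γ t⊨Γ =
      let t' , s'Rt' , t'⊨⋀Γ = stable λ none →
            s'⊭□¬⋀Γ (proj₂ (□-semantics M') λ t' s'Rt' t'⊨⋀Γ → none (t' , s'Rt' , t'⊨⋀Γ))
      in t' , s'Rt' , ⊨⋀⁻ M' Γ t'⊨⋀Γ
      where
      s'⊭□¬⋀Γ : ¬ M' ∣ _ ⊨ □ (¬ᶠ ⋀ Γ)
      s'⊭□¬⋀Γ = proj₁ (s≡s' (¬ᶠ □ (¬ᶠ ⋀ Γ)))
        λ s⊨□¬⋀Γ → proj₁ (□-semantics M) s⊨□¬⋀Γ t sRt (⊨⋀⁺ M Γ t⊨Γ)

    forth : ∀ M M' → SaturatedFor M' (R M') → ∀ s s' → ModallyEquivalent M M' s s' →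
            ∀ t → R M s t → ∃[ t' ] (R M' s' t' × ModallyEquivalent M M' t t')
    forth M M' saturated s s' s≡s' t sRt =
      let t' , s'Rt' , t'⊨Th = saturated s' (M ∣ t ⊨_) (finitely-realised M M' s≡s' sRt)
      in t' , s'Rt' , theory⊆⇒equivalent M M' t'⊨Th

    forthBack : ∀ M M' → SaturatedFor M (R M) → SaturatedFor M' (R M') →
                ForthBack M M' (ModallyEquivalent M M') (R M) (R M')
    forthBack M M' saturated saturated' s s' s≡s' =
      forth M M' saturated' s s' s≡s' ,
      λ t' s'Rt' → let t , sRt , t'≡t = forth M' M saturated s' s
                                          (ModallyEquivalent-sym M M' s≡s') t' s'Rt'
                   in t , sRt , ModallyEquivalent-sym M' M t'≡t

  equivalent⇒bisimilar : ∀ M M' → MSaturated M → MSaturated M' → ∀ {s s'} →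
    ModallyEquivalent M M' s s' → ∃[ B ] (IsBisimulation M M' B × B s s')
  equivalent⇒bisimilar M M' (saturated∼ , saturated≈) (saturated∼' , saturated≈') {s} {s'} s≡s' =
    ModallyEquivalent M M' ,
    ( (s , s' , s≡s')
    , (λ _ _ → equivalent⇒harmonious M M')
    , 𝒦.forthBack M M' saturated∼ saturated∼'
    , 𝒜.forthBack M M' saturated≈ saturated≈') ,
    s≡s'
    where
    module 𝒦 = HennessyMilner 𝒦 _∼_ (λ _ → id , id)
    module 𝒜 = HennessyMilner 𝒜 _≈_ (λ _ → id , id)

mainTheorem7 : ExcludedMiddle 0ℓ → {Prop Var : Set} → Countable Prop → Countable Var →
    (M M' : EDL.Model Prop Var) → EDL.Model.MSaturated M → EDL.Model.MSaturated M' →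
    (s : EDL.Model.S M) (s' : EDL.Model.S M') →
    ((∃[ B ] (EDL.IsBisimulation Prop Var M M' B × B s s')) → EDL.ModallyEquivalent Prop Var M M' s s')
    × (EDL.ModallyEquivalent Prop Var M M' s s' → ∃[ B ] (EDL.IsBisimulation Prop Var M M' B × B s s'))
mainTheorem7 em _ _ M M' saturated saturated' s s' =
  Classical.bisimilar⇒equivalent em M M' ,
  Classical.equivalent⇒bisimilar em M M' saturated saturated'
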